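{- Let $n\ge2$, $1\le i\le n-1$, and let $x^\alpha=x_1^{\alpha_1}\cdots x_n^{\alpha_n}\in\mathcal{A}_n$. Let $s_i(\alpha)$ be $\alpha$ with $\alpha_i,\alpha_{i+1}$ swapped, and let $\widetilde{x^{s_i(\alpha)}}$ be the normal form (full reduction) of $x^{s_i(\alpha)}$ modulo the Gröbner basis $\{g_k=h_k(x_k,\dots,x_n):1\le k\le n\}$ with respect to lexicographic order. If $x^{s_i(\alpha)}$ is reducible, then $\mathrm{lm}(\widetilde{x^{s_i(\alpha)}})\ge x^\alpha$ in lexicographic order, and if equality holds then $\mathrm{lt}(\widetilde{x^{s_i(\alpha)}})=-x^\alpha$.
   Context: Work in $\mathbb{C}[x_1,\dots,x_n]$ with the lexicographic monomial order in which $x_1>x_2>\cdots>x_n$. $h_k(x_k,\dots,x_n)$ is the complete homogeneous symmetric polynomial of degree $k$ in $x_k,\dots,x_n$; the set $\{g_k\}$ is a Gröbner basis of the ideal generated by the nonconstant symmetric polynomials, whose leading monomials are $x_k^k$. $\mathcal{A}_n=\{x_1^{\alpha_1}\cdots x_n^{\alpha_n}: 0\le\alpha_j<j \text{ for all } j\}$ (sub-staircase monomials), which are exactly the monomials not divisible by any $x_k^k$. A monomial is reducible if it is not in $\mathcal{A}_n$, i.e., divisible by some $x_k^k$. $\mathrm{lm}$ and $\mathrm{lt}$ denote the leading monomial and leading term (with coefficient) with respect to lexicographic order. -}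

module Defs where

open import Data.Nat using (ℕ; zero; suc; _≤_; _<_; _∸_)
import Data.Nat as ℕ
open import Data.Integer using (ℤ; +_; -_; _-_)
import Data.Integer as ℤ
open import Data.Fin using (Fin; toℕ)
open import Data.Vec using (Vec; []; _∷_; lookup; zipWith)
open import Data.Vec.Properties using (≡-dec)
open import Data.List using (List; []; _∷_; map; concatMap; upTo; _++_; foldr)
open import Data.List using () renaming ([] to []ₗ)
open import Data.Fin using () 
import Data.List as L
import Data.Fin as F
open import Data.Product using (_×_; _,_; Σ; ∃)
open import Data.Sum using (_⊎_)
open import Relation.Binary.PropositionalEquality using (_≡_)
open import Relation.Nullary using (¬_; yes; no)

-- Monomials in x_1,...,x_n are exponent vectors: position t (0-based) holds
-- the exponent of x_{t+1}.
Mono : ℕ → Set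
Mono n = Vec ℕ n

-- Polynomials with integer coefficients, as finite formal sums (lists of
-- coefficient/monomial pairs); equality is up to coefficients (see coeff).
Poly : ℕ → Set
Poly n = List (ℤ × Mono n)

_≟ᵐ_ : ∀ {n} (a b : Mono n) → Relation.Nullary.Dec (a ≡ b)
_≟ᵐ_ = ≡-dec ℕ._≟_

coeff : ∀ {n} → Poly n → Mono n → ℤ
coeff [] m = + 0
coeff ((c , m') ∷ p) m with m' ≟ᵐ m
... | yes _ = c ℤ.+ coeff p m
... | no  _ = coeff p m

monomial : ∀ {n} → Mono n → Poly n
monomial β = (+ 1 , β) ∷ []

_⊕_ : ∀ {n} → Poly n → Poly n → Poly n
p ⊕ q = p ++ q

_⊗_ : ∀ {n} → Poly n → Poly n → Poly n
p ⊗ q = concatMap (λ { (c , m) → map (λ { (d , m') → (c ℤ.* d , zipWith ℕ._+_ m m') }) q }) p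

comps : ℕ → (n : ℕ) → List (Mono n)
comps zero    zero    = [] ∷ []ₗ
comps (suc d) zero    = []ₗ
comps d       (suc n) = concatMap (λ a → map (a ∷_) (comps (d ∸ a) n)) (upTo (suc d))

tailMonos : ℕ → (n : ℕ) → ℕ → List (Mono n)
tailMonos zero    n       d = comps d n
tailMonos (suc j) zero    d = []ₗ
tailMonos (suc j) (suc n) d = map (0 ∷_) (tailMonos j n d)

-- g_k = h_k(x_k,...,x_n), indexed by j : Fin n with k = j+1
g : ∀ {n} → Fin n → Poly n
g {n} j = map (λ m → (+ 1 , m)) (tailMonos (toℕ j) n (suc (toℕ j)))

combo : ∀ {n} → (Fin n → Poly n) → Poly n
combo {n} q = foldr (λ j acc → (q j ⊗ g j) ⊕ acc) []ₗ (L.allFin n)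

Congruent : ∀ {n} → Poly n → Poly n → Set
Congruent {n} f r = Σ (Fin n → Poly n) λ q → ∀ m → coeff f m - coeff r m ≡ coeff (combo q) m

-- sub-staircase monomials A_n: α_j < j (1-based), i.e. α_t ≤ t (0-based)
InA : ∀ {n} → Mono n → Set
InA {n} α = ∀ (t : Fin n) → lookup α t ≤ toℕ t

Reducible : ∀ {n} → Mono n → Set
Reducible α = ¬ InA α

IsNormalForm : ∀ {n} → Poly n → Poly n → Set
IsNormalForm f r = (∀ m → ¬ coeff r m ≡ + 0 → InA m) × Congruent f r

-- lexicographic order with x_1 > x_2 > ... > x_n
data _≤lex_ : ∀ {n} → Mono n → Mono n → Set where
  []≤  : [] ≤lex []
  here : ∀ {n a b} {v w : Mono n} → a < b → (a ∷ v) ≤lex (b ∷ w)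
  there : ∀ {n a} {v w : Mono n} → v ≤lex w → (a ∷ v) ≤lex (a ∷ w)

IsLM : ∀ {n} → Poly n → Mono n → Set
IsLM r β = ¬ coeff r β ≡ + 0 × (∀ m → ¬ coeff r m ≡ + 0 → m ≤lex β)

swapAt : ∀ {n} → ℕ → Mono n → Mono n
swapAt zero    (a ∷ b ∷ v) = b ∷ a ∷ v
swapAt zero    v           = v
swapAt (suc k) (a ∷ v)     = a ∷ swapAt k v
swapAt (suc k) []          = []

-- s_i(α) for 1-based i: swaps α_i and α_{i+1}
s : ∀ {n} → ℕ → Mono n → Mono n
s i α = swapAt (i ∸ 1) α

{-# OPTIONS --safe #-}
-- Normal-form coefficients are computed by an explicit functional nf 0 τ,
-- sending x^μ to the coefficient of x^τ in the normal form of x^μ: the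
-- exponent of x_1 is reduced modulo g_1, then that of x_2 modulo g_2 in each
-- resulting coefficient, and so on, using that g_k is monic of degree k in x_k
-- over the later variables. This functional vanishes on the ideal, because
-- reducing x_k^a g_k with respect to x_k gives zero, and it is δ_τ on
-- sub-staircase monomials, so it reads off the coefficients of every normal
-- form.
--
-- If s_i(α) is reducible then α_{i+1} = i and α_i ≤ i - 1, so x^(s_i α)
-- contains x_i^i. Reducing it by g_i gives - x_i^(i-1) x_(i+1)^(α_i + 1) times
-- the untouched variables, which is sub-staircase, plus lex-smaller terms;
-- since reduction never raises a monomial in lex order, this is the leading
-- term, and its monomial is ≥ x^α because α_i ≤ i - 1.
module Submission where

open import Defs
import Data.Nat as ℕ
open import Data.Nat using (ℕ; zero; suc; _≤_; _<_; _∸_; s≤s; _≤?_)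
import Data.Nat.Properties as ℕₚ
open import Data.Integer using (ℤ; +_; -_; _+_; _*_; _-_)
import Data.Integer.Properties as ℤₚ
open import Data.Integer.Tactic.RingSolver using (solve-∀)
open import Data.Vec using ([]; _∷_; zipWith; replicate; lookup)
import Data.Vec.Properties as Vecₚ
open import Data.List using (List; []; _∷_; map; concatMap; upTo; allFin; _++_; foldr)
import Data.List.Properties as Listₚ
open import Data.Fin using (Fin; toℕ)
import Data.Fin as Fin
open import Data.Product using (Σ; _×_; _,_)
open import Data.Sum using (_⊎_; inj₁; inj₂)
open import Data.Empty using (⊥; ⊥-elim)
open import Data.Unit using (⊤)
open import Relation.Nullary using (¬_; Dec; yes; no)
open import Relation.Binary using (tri<; tri≈; tri>)
open import Relation.Binary.PropositionalEquality
open import Function using (_∘_)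

private
  variable
    m k : ℕ

infixl 7 _·_

_·_ : Mono m → Mono m → Mono m
_·_ = zipWith ℕ._+_

1ᵐ : Mono m
1ᵐ = replicate _ 0

·-identityˡ : ∀ (μ : Mono m) → 1ᵐ · μ ≡ μ
·-identityˡ = Vecₚ.zipWith-identityˡ ℕₚ.+-identityˡ

·-identityʳ : ∀ (μ : Mono m) → μ · 1ᵐ ≡ μ
·-identityʳ = Vecₚ.zipWith-identityʳ ℕₚ.+-identityʳ

·-comm : ∀ (μ ν : Mono m) → μ · ν ≡ ν · μ
·-comm = Vecₚ.zipWith-comm ℕₚ.+-comm

·-assoc : ∀ (μ ν ρ : Mono m) → (μ · ν) · ρ ≡ μ · (ν · ρ)
·-assoc = Vecₚ.zipWith-assoc ℕₚ.+-assoc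

-- Linear functionals on formal sums

lin : (Mono m → ℤ) → Poly m → ℤ
lin F []            = + 0
lin F ((c , μ) ∷ p) = c * F μ + lin F p

lin-cong : ∀ {F G : Mono m → ℤ} p → (∀ μ → F μ ≡ G μ) → lin F p ≡ lin G p
lin-cong []            F≗G = refl
lin-cong ((c , μ) ∷ p) F≗G = cong₂ (λ u v → c * u + v) (F≗G μ) (lin-cong p F≗G)

lin-zero : ∀ {F : Mono m → ℤ} p → (∀ μ → F μ ≡ + 0) → lin F p ≡ + 0
lin-zero []            F≗0 = refl
lin-zero ((c , μ) ∷ p) F≗0 rewrite F≗0 μ | lin-zero p F≗0 = trans (ℤₚ.+-identityʳ _) (ℤₚ.*-zeroʳ c)

lin-++ : ∀ (F : Mono m → ℤ) p q → lin F (p ++ q) ≡ lin F p + lin F q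
lin-++ F []            q = sym (ℤₚ.+-identityˡ _)
lin-++ F ((c , μ) ∷ p) q rewrite lin-++ F p q = sym (ℤₚ.+-assoc (c * F μ) _ _)

neg : Poly m → Poly m
neg = map (λ { (c , μ) → (- c , μ) })

lin-neg : ∀ (F : Mono m → ℤ) p → lin F (neg p) ≡ - lin F p
lin-neg F []            = refl
lin-neg F ((c , μ) ∷ p) rewrite lin-neg F p = law c (F μ) (lin F p)
  where
  law : ∀ c a x → - c * a + - x ≡ - (c * a + x)
  law = solve-∀

lin-+ : ∀ (F G : Mono m → ℤ) p → lin (λ μ → F μ + G μ) p ≡ lin F p + lin G p
lin-+ F G []            = refl
lin-+ F G ((c , μ) ∷ p) rewrite lin-+ F G p = law c (F μ) (G μ) (lin F p) (lin G p)
  where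
  law : ∀ c a b x y → c * (a + b) + (x + y) ≡ (c * a + x) + (c * b + y)
  law = solve-∀

lin-negate : ∀ (F : Mono m → ℤ) p → lin (λ μ → - F μ) p ≡ - lin F p
lin-negate F []            = refl
lin-negate F ((c , μ) ∷ p) rewrite lin-negate F p = law c (F μ) (lin F p)
  where
  law : ∀ c a x → c * - a + - x ≡ - (c * a + x)
  law = solve-∀

lin-scale : ∀ (a : ℤ) (F : Mono m → ℤ) p → lin (λ μ → a * F μ) p ≡ a * lin F p
lin-scale a F []            = sym (ℤₚ.*-zeroʳ a)
lin-scale a F ((c , μ) ∷ p) rewrite lin-scale a F p = law a c (F μ) (lin F p)
  where
  law : ∀ a c b x → c * (a * b) + a * x ≡ a * (c * b + x)
  law = solve-∀

lin-swap : ∀ (K : Mono m → Mono k → ℤ) p q →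
  lin (λ μ → lin (K μ) q) p ≡ lin (λ ν → lin (λ μ → K μ ν) p) q
lin-swap K []            q = sym (lin-zero q (λ _ → refl))
lin-swap K ((c , μ) ∷ p) q = begin
  c * lin (K μ) q + lin (λ μ → lin (K μ) q) p
    ≡⟨ cong₂ _+_ (sym (lin-scale c (K μ) q)) (lin-swap K p q) ⟩
  lin (λ ν → c * K μ ν) q + lin (λ ν → lin (λ μ → K μ ν) p) q
    ≡⟨ sym (lin-+ _ _ q) ⟩
  lin (λ ν → c * K μ ν + lin (λ μ → K μ ν) p) q ∎
  where open ≡-Reasoning

-- The inner pattern lambda of _⊗_ cannot be written down again, so it is
-- characterised by its action on pairs.
lin-map-shift : ∀ (F : Mono m → ℤ) c μ (h : ℤ × Mono m → ℤ × Mono m) →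
  (∀ d ν → h (d , ν) ≡ (c * d , μ · ν)) →
  ∀ q → lin F (map h q) ≡ c * lin (λ ν → F (μ · ν)) q
lin-map-shift F c μ h h-spec []            = sym (ℤₚ.*-zeroʳ c)
lin-map-shift F c μ h h-spec ((d , ν) ∷ q)
  rewrite h-spec d ν | lin-map-shift F c μ h h-spec q = law c d (F (μ · ν)) _
  where
  law : ∀ c d a x → c * d * a + c * x ≡ c * (d * a + x)
  law = solve-∀

lin-⊗ : ∀ (F : Mono m → ℤ) p q → lin F (p ⊗ q) ≡ lin (λ μ → lin (λ ν → F (μ · ν)) q) p
lin-⊗ F []            q = refl
lin-⊗ F ((c , μ) ∷ p) q =
  trans (lin-++ F (map _ q) (p ⊗ q))
        (cong₂ _+_ (lin-map-shift F c μ _ (λ _ _ → refl) q) (lin-⊗ F p q))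

δ : Mono m → Mono m → ℤ
δ μ τ with μ ≟ᵐ τ
... | yes _ = + 1
... | no  _ = + 0

δ-refl : ∀ (μ : Mono m) → δ μ μ ≡ + 1
δ-refl μ with μ ≟ᵐ μ
... | yes _  = refl
... | no μ≢μ = ⊥-elim (μ≢μ refl)

δ-≢ : ∀ {μ τ : Mono m} → μ ≢ τ → δ μ τ ≡ + 0
δ-≢ {μ = μ} {τ} μ≢τ with μ ≟ᵐ τ
... | yes μ≡τ = ⊥-elim (μ≢τ μ≡τ)
... | no  _   = refl

δ-∷-≡ : ∀ a (μ τ : Mono m) → δ (a ∷ μ) (a ∷ τ) ≡ δ μ τ
δ-∷-≡ a μ τ = by-cases (μ ≟ᵐ τ)
  where
  by-cases : Dec (μ ≡ τ) → δ (a ∷ μ) (a ∷ τ) ≡ δ μ τ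
  by-cases (yes refl) = trans (δ-refl (a ∷ μ)) (sym (δ-refl μ))
  by-cases (no μ≢τ)   = trans (δ-≢ (μ≢τ ∘ Vecₚ.∷-injectiveʳ)) (sym (δ-≢ μ≢τ))

δ-∷-≢ : ∀ {a b} (μ τ : Mono m) → a ≢ b → δ (a ∷ μ) (b ∷ τ) ≡ + 0
δ-∷-≢ μ τ a≢b = δ-≢ (a≢b ∘ Vecₚ.∷-injectiveˡ)

lin-δ : ∀ (τ : Mono m) p → lin (λ μ → δ μ τ) p ≡ coeff p τ
lin-δ τ []            = refl
lin-δ τ ((c , μ) ∷ p) with μ ≟ᵐ τ
... | yes _ rewrite lin-δ τ p | ℤₚ.*-identityʳ c = refl
... | no  _ rewrite lin-δ τ p | ℤₚ.*-zeroʳ c     = ℤₚ.+-identityˡ _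

coeff-++ : ∀ (p q : Poly m) τ → coeff (p ++ q) τ ≡ coeff p τ + coeff q τ
coeff-++ []            q τ = sym (ℤₚ.+-identityˡ _)
coeff-++ ((c , μ) ∷ p) q τ with μ ≟ᵐ τ
... | yes _ rewrite coeff-++ p q τ = sym (ℤₚ.+-assoc c _ _)
... | no  _ = coeff-++ p q τ

coeff-neg : ∀ (p : Poly m) τ → coeff (neg p) τ ≡ - coeff p τ
coeff-neg []            τ = refl
coeff-neg ((c , μ) ∷ p) τ with μ ≟ᵐ τ
... | yes _ rewrite coeff-neg p τ = sym (ℤₚ.neg-distrib-+ c _)
... | no  _ = coeff-neg p τ

coeff-∷-≢ : ∀ c {μ τ : Mono m} p → μ ≢ τ → coeff ((c , μ) ∷ p) τ ≡ coeff p τ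
coeff-∷-≢ c {μ} {τ} p μ≢τ with μ ≟ᵐ τ
... | yes μ≡τ = ⊥-elim (μ≢τ μ≡τ)
... | no  _   = refl

coeff-∷-≡ : ∀ c (μ : Mono m) p → coeff ((c , μ) ∷ p) μ ≡ c + coeff p μ
coeff-∷-≡ c μ p with μ ≟ᵐ μ
... | yes _  = refl
... | no μ≢μ = ⊥-elim (μ≢μ refl)

lin-extract : ∀ (F : Mono m → ℤ) ν p →
  lin F p ≡ coeff p ν * F ν + lin (λ μ → F μ - δ μ ν * F ν) p
lin-extract F ν p = begin
  lin F p
    ≡⟨ law (lin F p) (coeff p ν * F ν) ⟩
  coeff p ν * F ν + (lin F p - coeff p ν * F ν)
    ≡⟨ cong (λ x → coeff p ν * F ν + (lin F p - x)) extracted ⟩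
  coeff p ν * F ν + (lin F p + - lin (λ μ → δ μ ν * F ν) p)
    ≡⟨ cong (_+_ (coeff p ν * F ν)) (sym (trans (lin-+ F _ p) (cong (_+_ (lin F p)) (lin-negate _ p)))) ⟩
  coeff p ν * F ν + lin (λ μ → F μ - δ μ ν * F ν) p ∎
  where
  open ≡-Reasoning
  law : ∀ a b → a ≡ b + (a - b)
  law = solve-∀
  extracted : coeff p ν * F ν ≡ lin (λ μ → δ μ ν * F ν) p
  extracted = sym (trans (lin-cong p (λ μ → ℤₚ.*-comm (δ μ ν) (F ν)))
                  (trans (lin-scale (F ν) _ p) (trans (cong (F ν *_) (lin-δ ν p)) (ℤₚ.*-comm (F ν) _))))

lin-vanishes : ∀ (F : Mono m → ℤ) p → (∀ μ → coeff p μ ≡ + 0 ⊎ F μ ≡ + 0) → lin F p ≡ + 0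
lin-vanishes F []            _ = refl
lin-vanishes F ((c , ν) ∷ p) h = begin
  c * F ν + lin F p
    ≡⟨ cong (_+_ (c * F ν)) (lin-extract F ν p) ⟩
  c * F ν + (coeff p ν * F ν + lin F′ p)
    ≡⟨ law c (coeff p ν) (F ν) (lin F′ p) ⟩
  (c + coeff p ν) * F ν + lin F′ p
    ≡⟨ cong₂ _+_ head (lin-vanishes F′ p tail) ⟩
  + 0 ∎
  where
  open ≡-Reasoning
  F′ = λ μ → F μ - δ μ ν * F ν
  law : ∀ c d a x → c * a + (d * a + x) ≡ (c + d) * a + x
  law = solve-∀
  head : (c + coeff p ν) * F ν ≡ + 0
  head with h ν
  ... | inj₁ coeff≡0 rewrite sym (coeff-∷-≡ c ν p) | coeff≡0 = refl
  ... | inj₂ F≡0     rewrite F≡0 = ℤₚ.*-zeroʳ (c + coeff p ν)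
  tail : ∀ μ → coeff p μ ≡ + 0 ⊎ F′ μ ≡ + 0
  tail μ = by-cases (μ ≟ᵐ ν)
    where
    by-cases : Dec (μ ≡ ν) → coeff p μ ≡ + 0 ⊎ F′ μ ≡ + 0
    by-cases (yes refl) = inj₂ (begin
      F μ - δ μ μ * F μ ≡⟨ cong (λ d → F μ - d * F μ) (δ-refl μ) ⟩
      F μ - + 1 * F μ   ≡⟨ cong (_-_ (F μ)) (ℤₚ.*-identityˡ (F μ)) ⟩
      F μ - F μ         ≡⟨ ℤₚ.+-inverseʳ (F μ) ⟩
      + 0               ∎)
    by-cases (no μ≢ν) with h μ
    ... | inj₁ coeff≡0 = inj₁ (trans (sym (coeff-∷-≢ c p (μ≢ν ∘ sym))) coeff≡0)
    ... | inj₂ F≡0     = inj₂ (begin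
      F μ - δ μ ν * F ν ≡⟨ cong₂ (λ a d → a - d * F ν) F≡0 (δ-≢ μ≢ν) ⟩
      + 0 - + 0 * F ν   ≡⟨⟩
      + 0               ∎)

lin-cong-coeff : ∀ (F : Mono m → ℤ) p q → (∀ μ → coeff p μ ≡ coeff q μ) → lin F p ≡ lin F q
lin-cong-coeff F p q p≗q = begin
  lin F p                           ≡⟨ law (lin F p) (lin F q) ⟩
  (lin F p + - lin F q) + lin F q   ≡⟨ cong (_+ lin F q) (sym difference) ⟩
  lin F (p ++ neg q) + lin F q      ≡⟨ cong (_+ lin F q) (lin-vanishes F (p ++ neg q) cancels) ⟩
  + 0 + lin F q                     ≡⟨ ℤₚ.+-identityˡ _ ⟩
  lin F q                           ∎
  where
  open ≡-Reasoning
  law : ∀ a b → a ≡ (a + - b) + b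
  law = solve-∀
  difference : lin F (p ++ neg q) ≡ lin F p + - lin F q
  difference = trans (lin-++ F p (neg q)) (cong (_+_ (lin F p)) (lin-neg F q))
  cancels : ∀ μ → coeff (p ++ neg q) μ ≡ + 0 ⊎ F μ ≡ + 0
  cancels μ rewrite coeff-++ p (neg q) μ | coeff-neg q μ | p≗q μ = inj₁ (ℤₚ.+-inverseʳ (coeff q μ))

lin-⊗ʳ : ∀ (F : Mono m → ℤ) p q → lin F (p ⊗ q) ≡ lin (λ ν → lin (λ μ → F (μ · ν)) p) q
lin-⊗ʳ F p q = trans (lin-⊗ F p q) (lin-swap (λ μ ν → F (μ · ν)) p q)

lin-⊗-neg : ∀ (F : Mono m → ℤ) p q → lin F (p ⊗ neg q) ≡ - lin F (p ⊗ q)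
lin-⊗-neg F p q = begin
  lin F (p ⊗ neg q)                                 ≡⟨ lin-⊗ F p (neg q) ⟩
  lin (λ μ → lin (λ ν → F (μ · ν)) (neg q)) p       ≡⟨ lin-cong p (λ μ → lin-neg _ q) ⟩
  lin (λ μ → - lin (λ ν → F (μ · ν)) q) p           ≡⟨ lin-negate _ p ⟩
  - lin (λ μ → lin (λ ν → F (μ · ν)) q) p           ≡⟨ cong -_ (sym (lin-⊗ F p q)) ⟩
  - lin F (p ⊗ q)                                   ∎
  where open ≡-Reasoning

lin-⊗-++ : ∀ (F : Mono m → ℤ) p q r → lin F (p ⊗ (q ++ r)) ≡ lin F (p ⊗ q) + lin F (p ⊗ r)
lin-⊗-++ F p q r = begin
  lin F (p ⊗ (q ++ r))
    ≡⟨ lin-⊗ F p (q ++ r) ⟩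
  lin (λ μ → lin (λ ν → F (μ · ν)) (q ++ r)) p
    ≡⟨ lin-cong p (λ μ → lin-++ _ q r) ⟩
  lin (λ μ → lin (λ ν → F (μ · ν)) q + lin (λ ν → F (μ · ν)) r) p
    ≡⟨ lin-+ _ _ p ⟩
  lin (λ μ → lin (λ ν → F (μ · ν)) q) p + lin (λ μ → lin (λ ν → F (μ · ν)) r) p
    ≡⟨ sym (cong₂ _+_ (lin-⊗ F p q) (lin-⊗ F p r)) ⟩
  lin F (p ⊗ q) + lin F (p ⊗ r) ∎
  where open ≡-Reasoning

lin-⊗-⊗ : ∀ (F : Mono m → ℤ) p q r →
  lin F (p ⊗ (q ⊗ r)) ≡ lin (λ ρ → lin (λ κ → F (κ · ρ)) q) (p ⊗ r)
lin-⊗-⊗ F p q r = begin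
  lin F (p ⊗ (q ⊗ r))
    ≡⟨ lin-⊗ F p (q ⊗ r) ⟩
  lin (λ μ → lin (λ ν → F (μ · ν)) (q ⊗ r)) p
    ≡⟨ lin-cong p (λ μ → lin-⊗ʳ _ q r) ⟩
  lin (λ μ → lin (λ ρ → lin (λ κ → F (μ · (κ · ρ))) q) r) p
    ≡⟨ lin-cong p (λ μ → lin-cong r (λ ρ → lin-cong q (λ κ → cong F (exchange μ κ ρ)))) ⟩
  lin (λ μ → lin (λ ρ → lin (λ κ → F (κ · (μ · ρ))) q) r) p
    ≡⟨ sym (lin-⊗ _ p r) ⟩
  lin (λ ρ → lin (λ κ → F (κ · ρ)) q) (p ⊗ r) ∎
  where
  open ≡-Reasoning
  exchange : ∀ (μ κ ρ : Mono _) → μ · (κ · ρ) ≡ κ · (μ · ρ)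
  exchange μ κ ρ = trans (sym (·-assoc μ κ ρ)) (trans (cong (_· ρ) (·-comm μ κ)) (·-assoc κ μ ρ))

infixl 10 ∑

∑ : List ℕ → (ℕ → ℤ) → ℤ
∑ []       f = + 0
∑ (t ∷ ts) f = f t + ∑ ts f

syntax ∑ ts (λ t → e) = ∑[ t ∈ ts ] e

∑-cong : ∀ {f g : ℕ → ℤ} ts → (∀ t → f t ≡ g t) → ∑ ts f ≡ ∑ ts g
∑-cong []       f≗g = refl
∑-cong (t ∷ ts) f≗g = cong₂ _+_ (f≗g t) (∑-cong ts f≗g)

∑-+ : ∀ (f g : ℕ → ℤ) ts → ∑[ t ∈ ts ] (f t + g t) ≡ ∑ ts f + ∑ ts g
∑-+ f g []       = refl
∑-+ f g (t ∷ ts) rewrite ∑-+ f g ts = law (f t) (g t) (∑ ts f) (∑ ts g)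
  where
  law : ∀ a b x y → (a + b) + (x + y) ≡ (a + x) + (b + y)
  law = solve-∀

∑-negate : ∀ (f : ℕ → ℤ) ts → ∑[ t ∈ ts ] (- f t) ≡ - ∑ ts f
∑-negate f []       = refl
∑-negate f (t ∷ ts) rewrite ∑-negate f ts = sym (ℤₚ.neg-distrib-+ (f t) _)

∑-++ : ∀ (f : ℕ → ℤ) ts us → ∑ (ts ++ us) f ≡ ∑ ts f + ∑ us f
∑-++ f []       us = sym (ℤₚ.+-identityˡ _)
∑-++ f (t ∷ ts) us rewrite ∑-++ f ts us = sym (ℤₚ.+-assoc (f t) _ _)

∑-upTo-suc : ∀ (f : ℕ → ℤ) N → ∑ (upTo (suc N)) f ≡ ∑ (upTo N) f + f N
∑-upTo-suc f N = begin
  ∑ (upTo (suc N)) f              ≡⟨ cong (λ ts → ∑ ts f) (sym (Listₚ.upTo-∷ʳ N)) ⟩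
  ∑ (upTo N ++ N ∷ []) f          ≡⟨ ∑-++ f (upTo N) (N ∷ []) ⟩
  ∑ (upTo N) f + (f N + + 0)      ≡⟨ cong (_+_ (∑ (upTo N) f)) (ℤₚ.+-identityʳ (f N)) ⟩
  ∑ (upTo N) f + f N              ∎
  where open ≡-Reasoning

∑-upTo-zero : ∀ (f : ℕ → ℤ) N → (∀ t → t < N → f t ≡ + 0) → ∑ (upTo N) f ≡ + 0
∑-upTo-zero f zero    f≗0 = refl
∑-upTo-zero f (suc N) f≗0 = trans (∑-upTo-suc f N)
  (cong₂ _+_ (∑-upTo-zero f N (λ t t<N → f≗0 t (ℕₚ.m≤n⇒m≤1+n t<N))) (f≗0 N ℕₚ.≤-refl))

∑-upTo-select : ∀ (f : ℕ → ℤ) N b → b < N → (∀ t → t < N → t ≢ b → f t ≡ + 0) → ∑ (upTo N) f ≡ f b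
∑-upTo-select f (suc N) b b<1+N f≗0 with N ℕ.≟ b
... | yes refl = begin
  ∑ (upTo (suc N)) f      ≡⟨ ∑-upTo-suc f N ⟩
  ∑ (upTo N) f + f N      ≡⟨ cong (_+ f N) (∑-upTo-zero f N (λ t t<N → f≗0 t (ℕₚ.m≤n⇒m≤1+n t<N) (ℕₚ.<⇒≢ t<N))) ⟩
  + 0 + f N               ≡⟨ ℤₚ.+-identityˡ (f N) ⟩
  f N                     ∎
  where open ≡-Reasoning
... | no N≢b = begin
  ∑ (upTo (suc N)) f      ≡⟨ ∑-upTo-suc f N ⟩
  ∑ (upTo N) f + f N      ≡⟨ cong₂ _+_ (∑-upTo-select f N b b<N (λ t t<N → f≗0 t (ℕₚ.m≤n⇒m≤1+n t<N))) (f≗0 N ℕₚ.≤-refl N≢b) ⟩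
  f b + + 0               ≡⟨ ℤₚ.+-identityʳ (f b) ⟩
  f b                     ∎
  where
  open ≡-Reasoning
  b<N : b < N
  b<N = ℕₚ.≤∧≢⇒< (ℕₚ.≤-pred b<1+N) (N≢b ∘ sym)

lin-cong-support : ∀ (F G : Mono m → ℤ) p → (∀ μ → coeff p μ ≢ + 0 → F μ ≡ G μ) → lin F p ≡ lin G p
lin-cong-support F G p F≗G = begin
  lin F p                               ≡⟨ law (lin F p) (lin G p) ⟩
  (lin F p + - lin G p) + lin G p       ≡⟨ cong (_+ lin G p) difference ⟨
  lin (λ μ → F μ - G μ) p + lin G p     ≡⟨ cong (_+ lin G p) (lin-vanishes _ p agree) ⟩
  + 0 + lin G p                         ≡⟨ ℤₚ.+-identityˡ (lin G p) ⟩
  lin G p                               ∎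
  where
  open ≡-Reasoning
  law : ∀ a b → a ≡ (a + - b) + b
  law = solve-∀
  difference : lin (λ μ → F μ - G μ) p ≡ lin F p + - lin G p
  difference = trans (lin-+ F (λ μ → - G μ) p) (cong (_+_ (lin F p)) (lin-negate G p))
  agree : ∀ μ → coeff p μ ≡ + 0 ⊎ F μ - G μ ≡ + 0
  agree μ with coeff p μ ℤₚ.≟ + 0
  ... | yes c≡0 = inj₁ c≡0
  ... | no  c≢0 = inj₂ (trans (cong (_-_ (F μ)) (sym (F≗G μ c≢0))) (ℤₚ.+-inverseʳ (F μ)))

-- Reduction in a single variable

term : Mono m → ℤ × Mono m
term μ = (+ 1 , μ)

complete : ℕ → Poly m
complete d = map term (comps d _)

comps-zero : ∀ m → comps 0 m ≡ 1ᵐ ∷ []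
comps-zero zero    = refl
comps-zero (suc m) rewrite comps-zero m = refl

lin-complete-zero : ∀ (F : Mono m → ℤ) → lin F (complete 0) ≡ F 1ᵐ
lin-complete-zero {m} F rewrite comps-zero m = trans (ℤₚ.+-identityʳ _) (ℤₚ.*-identityˡ _)

lin-concatMap : ∀ (F : Mono m → ℤ) (f : ℕ → List (Mono m)) ts →
  lin F (map term (concatMap f ts)) ≡ ∑[ t ∈ ts ] lin F (map term (f t))
lin-concatMap F f []       = refl
lin-concatMap F f (t ∷ ts) = begin
  lin F (map term (f t ++ concatMap f ts))
    ≡⟨ cong (lin F) (Listₚ.map-++ term (f t) (concatMap f ts)) ⟩
  lin F (map term (f t) ++ map term (concatMap f ts))
    ≡⟨ lin-++ F (map term (f t)) _ ⟩
  lin F (map term (f t)) + lin F (map term (concatMap f ts))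
    ≡⟨ cong (_+_ (lin F (map term (f t)))) (lin-concatMap F f ts) ⟩
  lin F (map term (f t)) + ∑[ t ∈ ts ] lin F (map term (f t)) ∎
  where open ≡-Reasoning

lin-map-∷ : ∀ (F : Mono (suc m) → ℤ) t (μs : List (Mono m)) →
  lin F (map term (map (t ∷_) μs)) ≡ lin (λ ν → F (t ∷ ν)) (map term μs)
lin-map-∷ F t []       = refl
lin-map-∷ F t (μ ∷ μs) = cong (_+_ (+ 1 * F (t ∷ μ))) (lin-map-∷ F t μs)

lin-complete-zero-⊗ : ∀ (F : Mono m → ℤ) q → lin F (complete 0 ⊗ q) ≡ lin F q
lin-complete-zero-⊗ F q = begin
  lin F (complete 0 ⊗ q)                               ≡⟨ lin-⊗ F (complete 0) q ⟩
  lin (λ μ → lin (λ ν → F (μ · ν)) q) (complete 0)     ≡⟨ lin-complete-zero (λ μ → lin (λ ν → F (μ · ν)) q) ⟩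
  lin (λ ν → F (1ᵐ · ν)) q                             ≡⟨ lin-cong q (λ ν → cong F (·-identityˡ ν)) ⟩
  lin F q                                              ∎
  where open ≡-Reasoning

lin-complete-suc : ∀ (F : Mono (suc m) → ℤ) d →
  lin F (complete (suc d)) ≡ ∑[ t ∈ upTo (suc (suc d)) ] lin (λ ν → F (t ∷ ν)) (complete (suc d ∸ t))
lin-complete-suc {m} F d =
  trans (lin-concatMap F (λ t → map (t ∷_) (comps (suc d ∸ t) m)) (upTo (suc (suc d))))
        (∑-cong (upTo (suc (suc d))) (λ t → lin-map-∷ F t (comps (suc d ∸ t) m)))

lin-complete-one : ∀ (F : Mono (suc m) → ℤ) →
  lin F (complete 1) ≡ lin (λ ν → F (0 ∷ ν)) (complete 1) + F (1 ∷ 1ᵐ)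
lin-complete-one F =
  trans (lin-complete-suc F 0)
        (cong (_+_ (lin (λ ν → F (0 ∷ ν)) (complete 1)))
              (trans (ℤₚ.+-identityʳ _) (lin-complete-zero (λ ν → F (1 ∷ ν)))))

-- For a head variable x with x^(e+1) ≡ - ∑_{t ≤ e} x^t h_(e+1-t)(y) over tail
-- variables y, the power x^a reduces to ∑_{b ≤ e} x^b · rem e a b.
rem : ℕ → ℕ → ℕ → Poly m
rem e zero    zero    = term 1ᵐ ∷ []
rem e zero    (suc b) = []
rem e (suc a) zero    = neg (complete (suc e) ⊗ rem e a e)
rem e (suc a) (suc b) = rem e a b ++ neg (complete (suc e ∸ suc b) ⊗ rem e a e)

lin-neg-⊗ : ∀ (F : Mono m → ℤ) p q → lin F (neg (p ⊗ q)) ≡ - lin (λ ν → lin (λ ρ → F (ν · ρ)) q) p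
lin-neg-⊗ F p q = trans (lin-neg F (p ⊗ q)) (cong -_ (lin-⊗ F p q))

lin-rem-suc : ∀ e a b (F : Mono m → ℤ) →
  lin F (rem e (suc a) (suc b)) ≡ lin F (rem e a b) + - lin (λ ν → lin (λ ρ → F (ν · ρ)) (rem e a e)) (complete (e ∸ b))
lin-rem-suc e a b F =
  trans (lin-++ F (rem e a b) _) (cong (_+_ (lin F (rem e a b))) (lin-neg-⊗ F (complete (e ∸ b)) (rem e a e)))

rem-≢ : ∀ {e a b} → a ≤ e → a ≢ b → ∀ (F : Mono m → ℤ) → lin F (rem e a b) ≡ + 0
rem-≢ {e = e} {zero}  {zero}  _   0≢0 F = ⊥-elim (0≢0 refl)
rem-≢ {e = e} {zero}  {suc b} _   _   F = refl
rem-≢ {m} {e} {suc a} {zero}  a<e _   F =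
  trans (lin-neg-⊗ F (complete (suc e)) (rem e a e))
        (cong -_ (lin-zero (complete {m} (suc e)) (λ ν → rem-≢ (ℕₚ.<⇒≤ a<e) (ℕₚ.<⇒≢ a<e) _)))
rem-≢ {m} {e} {suc a} {suc b} a<e a≢b F =
  trans (lin-rem-suc e a b F)
        (cong₂ (λ x y → x + - y) (rem-≢ (ℕₚ.<⇒≤ a<e) (a≢b ∘ cong suc) F)
                                 (lin-zero (complete {m} (e ∸ b)) (λ ν → rem-≢ (ℕₚ.<⇒≤ a<e) (ℕₚ.<⇒≢ a<e) _)))

rem-≡ : ∀ {e a} → a ≤ e → ∀ (F : Mono m → ℤ) → lin F (rem e a a) ≡ F 1ᵐ
rem-≡ {e = e} {zero}  _   F = trans (ℤₚ.+-identityʳ _) (ℤₚ.*-identityˡ _)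
rem-≡ {m} {e} {suc a} a<e F =
  trans (lin-rem-suc e a a F)
        (trans (cong₂ (λ x y → x + - y) (rem-≡ (ℕₚ.<⇒≤ a<e) F)
                                        (lin-zero (complete {m} (e ∸ a)) (λ ν → rem-≢ (ℕₚ.<⇒≤ a<e) (ℕₚ.<⇒≢ a<e) _)))
               (ℤₚ.+-identityʳ (F 1ᵐ)))

lin-shift-rem-≡ : ∀ {e a} → a ≤ e → ∀ (F : Mono m → ℤ) C →
  lin (λ ν → lin (λ ρ → F (ν · ρ)) (rem e a a)) C ≡ lin F C
lin-shift-rem-≡ a≤e F C = lin-cong C (λ ν → trans (rem-≡ a≤e _) (cong F (·-identityʳ ν)))

rem-top : ∀ {e b} → b ≤ e → ∀ (F : Mono m → ℤ) → lin F (rem e (suc e) b) ≡ - lin F (complete (suc e ∸ b))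
rem-top {m} {e} {zero}  _   F =
  trans (lin-neg-⊗ F (complete (suc e)) (rem e e e)) (cong -_ (lin-shift-rem-≡ (ℕₚ.≤-refl {e}) F (complete (suc e))))
rem-top {m} {e} {suc b} b<e F =
  trans (lin-rem-suc e e b F)
        (trans (cong₂ (λ x y → x + - y) (rem-≢ ℕₚ.≤-refl (ℕₚ.<⇒≢ b<e ∘ sym) F)
                                        (lin-shift-rem-≡ (ℕₚ.≤-refl {e}) F (complete (e ∸ b))))
               (ℤₚ.+-identityˡ _))

lin-⊗-neg-⊗ : ∀ (F : Mono m → ℤ) p q r →
  lin F (p ⊗ neg (q ⊗ r)) ≡ - lin (λ ρ → lin (λ κ → F (κ · ρ)) q) (p ⊗ r)
lin-⊗-neg-⊗ F p q r = trans (lin-⊗-neg F p (q ⊗ r)) (cong -_ (lin-⊗-⊗ F p q r))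

-- Reducing x^a times the head relation ∑_t x^t h_(e+1-t)(y) gives zero.
rem-relation : ∀ e a {b} → b ≤ e → ∀ (F : Mono m → ℤ) →
  ∑[ t ∈ upTo (suc (suc e)) ] lin F (complete (suc e ∸ t) ⊗ rem e (a ℕ.+ t) b) ≡ + 0
rem-relation {m} e zero {b} b≤e F = begin
  -- only t = b and t = e + 1 contribute, with h_(e+1-b) and - h_(e+1-b)
  ∑ (upTo (suc (suc e))) f
    ≡⟨ ∑-upTo-suc f (suc e) ⟩
  ∑ (upTo (suc e)) f + f (suc e)
    ≡⟨ cong₂ _+_ (∑-upTo-select f (suc e) b (s≤s b≤e) off-diagonal) top ⟩
  f b + - lin F (complete (suc e ∸ b))
    ≡⟨ cong (_+ - lin F (complete (suc e ∸ b))) diagonal ⟩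
  lin F (complete (suc e ∸ b)) + - lin F (complete (suc e ∸ b))
    ≡⟨ ℤₚ.+-inverseʳ (lin F (complete (suc e ∸ b))) ⟩
  + 0 ∎
  where
  open ≡-Reasoning
  f : ℕ → ℤ
  f t = lin F (complete (suc e ∸ t) ⊗ rem e t b)
  off-diagonal : ∀ t → t < suc e → t ≢ b → f t ≡ + 0
  off-diagonal t t<1+e t≢b = trans (lin-⊗ F (complete (suc e ∸ t)) (rem e t b))
    (lin-zero (complete {m} (suc e ∸ t)) (λ ν → rem-≢ (ℕₚ.≤-pred t<1+e) t≢b _))
  diagonal : f b ≡ lin F (complete (suc e ∸ b))
  diagonal = trans (lin-⊗ F (complete (suc e ∸ b)) (rem e b b)) (lin-shift-rem-≡ b≤e F (complete (suc e ∸ b)))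
  top : f (suc e) ≡ - lin F (complete (suc e ∸ b))
  top = begin
    lin F (complete (e ∸ e) ⊗ rem e (suc e) b) ≡⟨ cong (λ d → lin F (complete d ⊗ rem e (suc e) b)) (ℕₚ.n∸n≡0 e) ⟩
    lin F (complete 0 ⊗ rem e (suc e) b)       ≡⟨ lin-complete-zero-⊗ F (rem e (suc e) b) ⟩
    lin F (rem e (suc e) b)                    ≡⟨ rem-top b≤e F ⟩
    - lin F (complete (suc e ∸ b))             ∎
rem-relation e (suc a) {zero} _ F = begin
  ∑[ t ∈ ts ] lin F (complete (suc e ∸ t) ⊗ neg (complete (suc e) ⊗ rem e (a ℕ.+ t) e))
    ≡⟨ ∑-cong ts (λ t → lin-⊗-neg-⊗ F (complete (suc e ∸ t)) (complete (suc e)) (rem e (a ℕ.+ t) e)) ⟩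
  ∑[ t ∈ ts ] (- lin F′ (complete (suc e ∸ t) ⊗ rem e (a ℕ.+ t) e))
    ≡⟨ ∑-negate (λ t → lin F′ (complete (suc e ∸ t) ⊗ rem e (a ℕ.+ t) e)) ts ⟩
  - ∑[ t ∈ ts ] lin F′ (complete (suc e ∸ t) ⊗ rem e (a ℕ.+ t) e)
    ≡⟨ cong -_ (rem-relation e a ℕₚ.≤-refl F′) ⟩
  + 0 ∎
  where
  open ≡-Reasoning
  ts = upTo (suc (suc e))
  F′ = λ ρ → lin (λ κ → F (κ · ρ)) (complete (suc e))
rem-relation e (suc a) {suc b} b<e F = begin
  ∑[ t ∈ ts ] lin F (complete (suc e ∸ t) ⊗ (rem e (a ℕ.+ t) b ++ neg (complete (e ∸ b) ⊗ rem e (a ℕ.+ t) e)))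
    ≡⟨ ∑-cong ts (λ t → split (complete (suc e ∸ t)) (rem e (a ℕ.+ t) b) (rem e (a ℕ.+ t) e)) ⟩
  ∑[ t ∈ ts ] (lin F (complete (suc e ∸ t) ⊗ rem e (a ℕ.+ t) b)
               + - lin F′ (complete (suc e ∸ t) ⊗ rem e (a ℕ.+ t) e))
    ≡⟨ ∑-+ (λ t → lin F (complete (suc e ∸ t) ⊗ rem e (a ℕ.+ t) b)) (λ t → - F′-term t) ts ⟩
  ∑[ t ∈ ts ] lin F (complete (suc e ∸ t) ⊗ rem e (a ℕ.+ t) b)
    + ∑[ t ∈ ts ] (- lin F′ (complete (suc e ∸ t) ⊗ rem e (a ℕ.+ t) e))
    ≡⟨ cong₂ _+_ (rem-relation e a (ℕₚ.<⇒≤ b<e) F) (trans (∑-negate F′-term ts) (cong -_ (rem-relation e a ℕₚ.≤-refl F′))) ⟩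
  + 0 ∎
  where
  open ≡-Reasoning
  ts = upTo (suc (suc e))
  F′ = λ ρ → lin (λ κ → F (κ · ρ)) (complete (e ∸ b))
  F′-term = λ t → lin F′ (complete (suc e ∸ t) ⊗ rem e (a ℕ.+ t) e)
  split : ∀ p q r → lin F (p ⊗ (q ++ neg (complete (e ∸ b) ⊗ r))) ≡ lin F (p ⊗ q) + - lin F′ (p ⊗ r)
  split p q r = trans (lin-⊗-++ F p q _) (cong (_+_ (lin F (p ⊗ q))) (lin-⊗-neg-⊗ F p (complete (e ∸ b)) r))

-- The normal-form functional

-- nf e τ μ is the coefficient of x^τ in the normal form of x^μ when the
-- variables are those from position e on (0-based), so that the j-th of them
-- has exponent bound e + j; nf 0 is the case of the theorem.
nf : ℕ → Mono m → Mono m → ℤ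
nf e []      []      = + 1
nf e (b ∷ τ) (a ∷ μ) with b ≤? e
... | yes _ = lin (λ ρ → nf (suc e) τ (ρ · μ)) (rem e a b)
... | no  _ = + 0

nf-∷-≤ : ∀ {e} b a (τ μ : Mono m) → b ≤ e →
  nf e (b ∷ τ) (a ∷ μ) ≡ lin (λ ρ → nf (suc e) τ (ρ · μ)) (rem e a b)
nf-∷-≤ {e = e} b a τ μ b≤e with b ≤? e
... | yes _   = refl
... | no  b≰e = ⊥-elim (b≰e b≤e)

nf-∷-≰ : ∀ {e} b a (τ μ : Mono m) → ¬ b ≤ e → nf e (b ∷ τ) (a ∷ μ) ≡ + 0
nf-∷-≰ {e = e} b a τ μ b≰e with b ≤? e
... | yes b≤e = ⊥-elim (b≰e b≤e)
... | no  _   = refl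

nf-∷-≡ : ∀ {e} a (τ μ : Mono m) → a ≤ e → nf e (a ∷ τ) (a ∷ μ) ≡ nf (suc e) τ μ
nf-∷-≡ a τ μ a≤e = trans (nf-∷-≤ a a τ μ a≤e) (trans (rem-≡ a≤e _) (cong (nf _ τ) (·-identityˡ μ)))

nf-∷-≢ : ∀ {e} b a (τ μ : Mono m) → a ≤ e → a ≢ b → nf e (b ∷ τ) (a ∷ μ) ≡ + 0
nf-∷-≢ {e = e} b a τ μ a≤e a≢b with b ≤? e
... | yes _ = rem-≢ a≤e a≢b _
... | no  _ = refl

Staircase : ℕ → Mono m → Set
Staircase e []      = ⊤
Staircase e (a ∷ μ) = a ≤ e × Staircase (suc e) μ

staircase-from-bounds : ∀ e (μ : Mono m) → (∀ t → lookup μ t ≤ e ℕ.+ toℕ t) → Staircase e μ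
staircase-from-bounds e []      _      = _
staircase-from-bounds e (a ∷ μ) bounds =
  subst (a ≤_) (ℕₚ.+-identityʳ e) (bounds Fin.zero) ,
  staircase-from-bounds (suc e) μ (λ t → subst (lookup μ t ≤_) (ℕₚ.+-suc e (toℕ t)) (bounds (Fin.suc t)))

staircase-to-bounds : ∀ e (μ : Mono m) → Staircase e μ → ∀ t → lookup μ t ≤ e ℕ.+ toℕ t
staircase-to-bounds e (a ∷ μ) (a≤e , _) Fin.zero    = subst (a ≤_) (sym (ℕₚ.+-identityʳ e)) a≤e
staircase-to-bounds e (a ∷ μ) (_ , μ-st) (Fin.suc t) =
  subst (lookup μ t ≤_) (sym (ℕₚ.+-suc e (toℕ t))) (staircase-to-bounds (suc e) μ μ-st t)

nf-staircase : ∀ e (τ μ : Mono m) → Staircase e μ → nf e τ μ ≡ δ μ τ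
nf-staircase e []      []      _            = sym (δ-refl [])
nf-staircase e (b ∷ τ) (a ∷ μ) (a≤e , μ-st) = by-cases (a ℕ.≟ b)
  where
  by-cases : Dec (a ≡ b) → nf e (b ∷ τ) (a ∷ μ) ≡ δ (a ∷ μ) (b ∷ τ)
  by-cases (yes refl) = trans (nf-∷-≡ a τ μ a≤e) (trans (nf-staircase (suc e) τ μ μ-st) (sym (δ-∷-≡ a μ τ)))
  by-cases (no a≢b)   = trans (nf-∷-≢ b a τ μ a≤e a≢b) (sym (δ-∷-≢ μ τ a≢b))

data _<lex_ : Mono m → Mono m → Set where
  here  : ∀ {a b} {v w : Mono m} → a < b → (a ∷ v) <lex (b ∷ w)
  there : ∀ {a} {v w : Mono m} → v <lex w → (a ∷ v) <lex (a ∷ w)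

nf-<lex : ∀ e (τ μ : Mono m) → μ <lex τ → nf e τ μ ≡ + 0
nf-<lex e (b ∷ τ) (a ∷ μ) (here a<b) with b ≤? e
... | yes b≤e = rem-≢ (ℕₚ.≤-trans (ℕₚ.<⇒≤ a<b) b≤e) (ℕₚ.<⇒≢ a<b) _
... | no  _   = refl
nf-<lex e (a ∷ τ) (a ∷ μ) (there μ<τ) with a ≤? e
... | yes a≤e = trans (rem-≡ a≤e _) (trans (cong (nf (suc e) τ) (·-identityˡ μ)) (nf-<lex (suc e) τ μ μ<τ))
... | no  _   = refl

-- With d = e + j + 1, map term (tailMonos j m d) is g_d written in the
-- variables from position e on.
nf-kills-relation : ∀ e (j : Fin m) d → d ≡ suc (toℕ j ℕ.+ e) → ∀ (τ μ : Mono m) →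
  lin (λ ν → nf e τ (μ · ν)) (map term (tailMonos (toℕ j) m d)) ≡ + 0
nf-kills-relation e Fin.zero _ refl (b ∷ τ) (a ∷ μ) = begin
  lin G (complete (suc e))
    ≡⟨ lin-complete-suc G e ⟩
  ∑[ t ∈ ts ] lin (λ ν → G (t ∷ ν)) (complete (suc e ∸ t))
    ≡⟨ by-cases (b ≤? e) ⟩
  + 0 ∎
  where
  open ≡-Reasoning
  G = λ ν → nf e (b ∷ τ) ((a ∷ μ) · ν)
  ts = upTo (suc (suc e))
  by-cases : Dec (b ≤ e) → ∑[ t ∈ ts ] lin (λ ν → G (t ∷ ν)) (complete (suc e ∸ t)) ≡ + 0
  by-cases (yes b≤e) = trans (∑-cong ts t-th) (rem-relation e a b≤e F)
    where
    F = λ y → nf (suc e) τ (y · μ)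
    rearrange : ∀ ρ ν → ρ · (μ · ν) ≡ (ν · ρ) · μ
    rearrange ρ ν = begin
      ρ · (μ · ν) ≡⟨ cong (ρ ·_) (·-comm μ ν) ⟩
      ρ · (ν · μ) ≡⟨ ·-assoc ρ ν μ ⟨
      ρ · ν · μ   ≡⟨ cong (_· μ) (·-comm ρ ν) ⟩
      ν · ρ · μ   ∎
    t-th : ∀ t → lin (λ ν → G (t ∷ ν)) (complete (suc e ∸ t)) ≡ lin F (complete (suc e ∸ t) ⊗ rem e (a ℕ.+ t) b)
    t-th t = begin
      lin (λ ν → G (t ∷ ν)) C
        ≡⟨ lin-cong C (λ ν → nf-∷-≤ b (a ℕ.+ t) τ (μ · ν) b≤e) ⟩
      lin (λ ν → lin (λ ρ → nf (suc e) τ (ρ · (μ · ν))) R) C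
        ≡⟨ lin-cong C (λ ν → lin-cong R (λ ρ → cong (nf (suc e) τ) (rearrange ρ ν))) ⟩
      lin (λ ν → lin (λ ρ → F (ν · ρ)) R) C
        ≡⟨ lin-⊗ F C R ⟨
      lin F (C ⊗ R) ∎
      where
      C = complete (suc e ∸ t)
      R = rem e (a ℕ.+ t) b
  by-cases (no b≰e) = ∑-upTo-zero _ (suc (suc e)) (λ t _ →
    lin-zero (complete (suc e ∸ t)) (λ ν → nf-∷-≰ b (a ℕ.+ t) τ (μ · ν) b≰e))
nf-kills-relation {suc m} e (Fin.suc j) d d≡ (b ∷ τ) (a ∷ μ) = begin
  lin G (map term (map (0 ∷_) Gs))
    ≡⟨ lin-map-∷ G 0 Gs ⟩
  lin (λ ν → G (0 ∷ ν)) (map term Gs)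
    ≡⟨ by-cases (b ≤? e) ⟩
  + 0 ∎
  where
  open ≡-Reasoning
  G = λ ν → nf e (b ∷ τ) ((a ∷ μ) · ν)
  Gs = tailMonos (toℕ j) m d
  d≡′ : d ≡ suc (toℕ j ℕ.+ suc e)
  d≡′ = trans d≡ (cong suc (sym (ℕₚ.+-suc (toℕ j) e)))
  by-cases : Dec (b ≤ e) → lin (λ ν → G (0 ∷ ν)) (map term Gs) ≡ + 0
  by-cases (yes b≤e) = begin
    lin (λ ν → G (0 ∷ ν)) (map term Gs)
      ≡⟨ lin-cong (map term Gs) (λ ν → nf-∷-≤ b (a ℕ.+ 0) τ (μ · ν) b≤e) ⟩
    lin (λ ν → lin (λ ρ → nf (suc e) τ (ρ · (μ · ν))) R) (map term Gs)
      ≡⟨ lin-swap (λ ν ρ → nf (suc e) τ (ρ · (μ · ν))) (map term Gs) R ⟩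
    lin (λ ρ → lin (λ ν → nf (suc e) τ (ρ · (μ · ν))) (map term Gs)) R
      ≡⟨ lin-zero R (λ ρ → trans (lin-cong (map term Gs) (λ ν → cong (nf (suc e) τ) (sym (·-assoc ρ μ ν))))
                                 (nf-kills-relation (suc e) j d d≡′ τ (ρ · μ))) ⟩
    + 0 ∎
    where R = rem e (a ℕ.+ 0) b
  by-cases (no b≰e) = lin-zero (map term Gs) (λ ν → nf-∷-≰ b (a ℕ.+ 0) τ (μ · ν) b≰e)

nf-kills-ideal : ∀ (τ : Mono m) q → lin (nf 0 τ) (combo q) ≡ + 0
nf-kills-ideal {m} τ q = over (allFin m)
  where
  open ≡-Reasoning
  over : ∀ js → lin (nf 0 τ) (foldr (λ j acc → (q j ⊗ g j) ⊕ acc) [] js) ≡ + 0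
  over []       = refl
  over (j ∷ js) = begin
    lin (nf 0 τ) ((q j ⊗ g j) ++ rest)            ≡⟨ lin-++ (nf 0 τ) (q j ⊗ g j) rest ⟩
    lin (nf 0 τ) (q j ⊗ g j) + lin (nf 0 τ) rest  ≡⟨ cong₂ _+_ kills-j (over js) ⟩
    + 0                                           ∎
    where
    rest = foldr (λ j acc → (q j ⊗ g j) ⊕ acc) [] js
    kills-j : lin (nf 0 τ) (q j ⊗ g j) ≡ + 0
    kills-j = trans (lin-⊗ (nf 0 τ) (q j) (g j)) (lin-zero (q j) (λ μ →
      nf-kills-relation 0 j _ (cong suc (sym (ℕₚ.+-identityʳ (toℕ j)))) τ μ))

normalForm-coeff : ∀ (F : Mono m → ℤ) τ → (∀ q → lin F (combo q) ≡ + 0) →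
  (∀ μ → InA μ → F μ ≡ δ μ τ) → ∀ {f r} → IsNormalForm f r → coeff r τ ≡ lin F f
normalForm-coeff F τ F-kills F-δ {f} {r} (r-reduced , q , f-r≡combo) = begin
  coeff r τ                         ≡⟨ lin-δ τ r ⟨
  lin (λ μ → δ μ τ) r               ≡⟨ lin-cong-support _ F r (λ μ c≢0 → sym (F-δ μ (r-reduced μ c≢0))) ⟩
  lin F r                           ≡⟨ law (lin F f) (lin F r) ⟩
  lin F f - (lin F f + - lin F r)   ≡⟨ cong (_-_ (lin F f)) difference ⟩
  lin F f - + 0                     ≡⟨ ℤₚ.+-identityʳ (lin F f) ⟩
  lin F f                           ∎
  where
  open ≡-Reasoning
  law : ∀ a b → b ≡ a - (a + - b)
  law = solve-∀
  difference : lin F f + - lin F r ≡ + 0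
  difference = begin
    lin F f + - lin F r  ≡⟨ trans (lin-++ F f (neg r)) (cong (_+_ (lin F f)) (lin-neg F r)) ⟨
    lin F (f ++ neg r)   ≡⟨ lin-cong-coeff F (f ++ neg r) (combo q) (λ μ →
                              trans (coeff-++ f (neg r) μ) (trans (cong (_+_ (coeff f μ)) (coeff-neg r μ)) (f-r≡combo μ))) ⟩
    lin F (combo q)      ≡⟨ F-kills q ⟩
    + 0                  ∎

coeff-normalForm : ∀ (σ : Mono m) {r} → IsNormalForm (monomial σ) r → ∀ τ → coeff r τ ≡ nf 0 τ σ
coeff-normalForm σ {r} r-nf τ =
  trans (normalForm-coeff (nf 0 τ) τ (nf-kills-ideal τ) (λ μ μ∈A → nf-staircase 0 τ μ (staircase-from-bounds 0 μ μ∈A))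
                          {monomial σ} {r} r-nf)
        (trans (ℤₚ.+-identityʳ _) (ℤₚ.*-identityˡ _))

-- The normal form of x^(s_i α)

≤lex-refl : ∀ (v : Mono m) → v ≤lex v
≤lex-refl []      = []≤
≤lex-refl (a ∷ v) = there (≤lex-refl v)

≤lex-or->lex : ∀ (u v : Mono m) → u ≤lex v ⊎ v <lex u
≤lex-or->lex []      []      = inj₁ []≤
≤lex-or->lex (a ∷ u) (b ∷ v) with ℕₚ.<-cmp a b
... | tri< a<b _ _ = inj₁ (here a<b)
... | tri> _ _ b<a = inj₂ (here b<a)
... | tri≈ _ refl _ with ≤lex-or->lex u v
...   | inj₁ u≤v = inj₁ (there u≤v)
...   | inj₂ v<u = inj₂ (there v<u)

<lex-lower-head : ∀ {a} {v w : Mono m} {τ} → (suc a ∷ v) <lex τ → (a ∷ w) <lex τ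
<lex-lower-head (here 1+a<b) = here (ℕₚ.<-trans (ℕₚ.n<1+n _) 1+a<b)
<lex-lower-head (there _)    = here (ℕₚ.n<1+n _)

IsLM-intro : ∀ (r : Poly m) γ → coeff r γ ≢ + 0 → (∀ β → γ <lex β → coeff r β ≡ + 0) → IsLM r γ
IsLM-intro r γ γ-coeff≢0 above-γ = γ-coeff≢0 , below-γ
  where
  below-γ : ∀ β → coeff r β ≢ + 0 → β ≤lex γ
  below-γ β β-coeff≢0 with ≤lex-or->lex β γ
  ... | inj₁ β≤γ = β≤γ
  ... | inj₂ γ<β = ⊥-elim (β-coeff≢0 (above-γ β γ<β))

SwapOverflow : ℕ → ℕ → Mono m → Set
SwapOverflow e zero    (a ∷ b ∷ v) = a ≤ e × b ≡ suc e × Staircase (suc (suc e)) v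
SwapOverflow e (suc p) (a ∷ v)     = a ≤ e × SwapOverflow (suc e) p v
SwapOverflow _ _       _           = ⊥

swap-overflow : ∀ e p (α : Mono m) → Staircase e α → ¬ Staircase e (swapAt p α) → SwapOverflow e p α
swap-overflow e zero    []          α-st ¬st = ⊥-elim (¬st α-st)
swap-overflow e zero    (a ∷ [])    α-st ¬st = ⊥-elim (¬st α-st)
swap-overflow e zero    (a ∷ b ∷ v) (a≤e , b≤1+e , v-st) ¬st with b ≤? e
... | yes b≤e = ⊥-elim (¬st (b≤e , ℕₚ.m≤n⇒m≤1+n a≤e , v-st))
... | no  b≰e = a≤e , ℕₚ.≤-antisym b≤1+e (ℕₚ.≰⇒> b≰e) , v-st
swap-overflow e (suc p) []      α-st         ¬st = ⊥-elim (¬st α-st)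
swap-overflow e (suc p) (a ∷ v) (a≤e , v-st) ¬st = a≤e , swap-overflow (suc e) p v v-st (¬st ∘ (a≤e ,_))

swapLead : ℕ → Mono m → Mono m
swapLead zero    (a ∷ b ∷ v) = ℕ.pred b ∷ suc a ∷ v
swapLead (suc p) (a ∷ v)     = a ∷ swapLead p v
swapLead _       v           = v

≤lex-swapLead : ∀ e p (α : Mono m) → SwapOverflow e p α → α ≤lex swapLead p α
≤lex-swapLead e zero    (a ∷ b ∷ v) (a≤e , refl , _) with ℕₚ.m≤n⇒m<n∨m≡n a≤e
... | inj₁ a<e  = here a<e
... | inj₂ refl = there (there (≤lex-refl v))
≤lex-swapLead e (suc p) (a ∷ v)     (_ , overflow)   = there (≤lex-swapLead (suc e) p v overflow)

-- The x^e-coefficient of x^(e+1) is - h_1(y), and h_1(y_1, y′) = y_1 + h_1(y′).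
nf-overflow : ∀ e a (v : Mono m) τ →
  nf e (e ∷ τ) (suc e ∷ a ∷ v) ≡ - (lin (λ ν → nf (suc e) τ (a ∷ ν · v)) (complete 1) + nf (suc e) τ (suc a ∷ v))
nf-overflow e a v τ = begin
  nf e (e ∷ τ) (suc e ∷ a ∷ v)
    ≡⟨ nf-∷-≤ e (suc e) τ (a ∷ v) (ℕₚ.≤-refl {e}) ⟩
  lin F (rem e (suc e) e)
    ≡⟨ rem-top (ℕₚ.≤-refl {e}) F ⟩
  - lin F (complete (suc e ∸ e))
    ≡⟨ cong (λ d → - lin F (complete d)) (ℕₚ.m+n∸n≡m 1 e) ⟩
  - lin F (complete 1)
    ≡⟨ cong -_ (lin-complete-one F) ⟩
  - (lin (λ ν → nf (suc e) τ (a ∷ ν · v)) (complete 1) + nf (suc e) τ (suc a ∷ 1ᵐ · v))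
    ≡⟨ cong (λ w → - (lin (λ ν → nf (suc e) τ (a ∷ ν · v)) (complete 1) + nf (suc e) τ (suc a ∷ w))) (·-identityˡ v) ⟩
  - (lin (λ ν → nf (suc e) τ (a ∷ ν · v)) (complete 1) + nf (suc e) τ (suc a ∷ v)) ∎
  where
  open ≡-Reasoning
  F = λ ρ → nf (suc e) τ (ρ · (a ∷ v))

nf-swapLead : ∀ e p (α : Mono m) → SwapOverflow e p α → nf e (swapLead p α) (swapAt p α) ≡ - (+ 1)
nf-swapLead e zero (a ∷ b ∷ v) (a≤e , refl , v-st) = begin
  nf e (e ∷ suc a ∷ v) (suc e ∷ a ∷ v)
    ≡⟨ nf-overflow e a v (suc a ∷ v) ⟩
  - (lin (λ ν → nf (suc e) (suc a ∷ v) (a ∷ ν · v)) (complete 1) + nf (suc e) (suc a ∷ v) (suc a ∷ v))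
    ≡⟨ cong₂ (λ x y → - (x + y)) below lead ⟩
  - (+ 0 + + 1) ∎
  where
  open ≡-Reasoning
  below : lin (λ ν → nf (suc e) (suc a ∷ v) (a ∷ ν · v)) (complete 1) ≡ + 0
  below = lin-zero (complete 1) (λ ν → nf-<lex (suc e) (suc a ∷ v) (a ∷ ν · v) (here (ℕₚ.n<1+n a)))
  lead : nf (suc e) (suc a ∷ v) (suc a ∷ v) ≡ + 1
  lead = trans (nf-staircase (suc e) (suc a ∷ v) (suc a ∷ v) (s≤s a≤e , v-st)) (δ-refl (suc a ∷ v))
nf-swapLead e (suc p) (a ∷ v) (a≤e , overflow) =
  trans (nf-∷-≡ a (swapLead p v) (swapAt p v) a≤e) (nf-swapLead (suc e) p v overflow)

nf-above-swapLead : ∀ e p (α : Mono m) → SwapOverflow e p α →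
  ∀ τ → swapLead p α <lex τ → nf e τ (swapAt p α) ≡ + 0
nf-above-swapLead e zero (a ∷ b ∷ v) (_ , refl , _) (c ∷ τ) (here e<c) = nf-∷-≰ c (suc e) τ (a ∷ v) (ℕₚ.<⇒≱ e<c)
nf-above-swapLead e zero (a ∷ b ∷ v) (_ , refl , _) (.e ∷ τ) (there lead<τ) = begin
  nf e (e ∷ τ) (suc e ∷ a ∷ v)
    ≡⟨ nf-overflow e a v τ ⟩
  - (lin (λ ν → nf (suc e) τ (a ∷ ν · v)) (complete 1) + nf (suc e) τ (suc a ∷ v))
    ≡⟨ cong₂ (λ x y → - (x + y)) below (nf-<lex (suc e) τ (suc a ∷ v) lead<τ) ⟩
  - (+ 0 + + 0) ∎
  where
  open ≡-Reasoning
  below : lin (λ ν → nf (suc e) τ (a ∷ ν · v)) (complete 1) ≡ + 0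
  below = lin-zero (complete 1) (λ ν → nf-<lex (suc e) τ (a ∷ ν · v) (<lex-lower-head lead<τ))
nf-above-swapLead e (suc p) (a ∷ v) (a≤e , _) (b ∷ τ) (here a<b) = nf-∷-≢ b a τ (swapAt p v) a≤e (ℕₚ.<⇒≢ a<b)
nf-above-swapLead e (suc p) (a ∷ v) (a≤e , overflow) (.a ∷ τ) (there lead<τ) =
  trans (nf-∷-≡ a τ (swapAt p v) a≤e) (nf-above-swapLead (suc e) p v overflow τ lead<τ)

proposition6 : (n : ℕ) → 2 ≤ n → (i : ℕ) → 1 ≤ i → i ≤ n ∸ 1 →
    (α : Mono n) → InA α → Reducible (s i α) →
    (r : Poly n) → IsNormalForm (monomial (s i α)) r →
    Σ (Mono n) λ β → IsLM r β × α ≤lex β × (β ≡ α → coeff r α ≡ - (+ 1))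
proposition6 n _ i _ _ α α∈A sα-reducible r r-nf =
  γ , IsLM-intro r γ γ-coeff≢0 above-γ , ≤lex-swapLead 0 p α overflow , (λ γ≡α → subst (λ β → coeff r β ≡ - (+ 1)) γ≡α γ-coeff)
  where
  p = i ∸ 1
  γ = swapLead p α
  overflow : SwapOverflow 0 p α
  overflow = swap-overflow 0 p α (staircase-from-bounds 0 α α∈A) (sα-reducible ∘ staircase-to-bounds 0 (swapAt p α))
  γ-coeff : coeff r γ ≡ - (+ 1)
  γ-coeff = trans (coeff-normalForm (swapAt p α) {r} r-nf γ) (nf-swapLead 0 p α overflow)
  γ-coeff≢0 : coeff r γ ≢ + 0
  γ-coeff≢0 γ-coeff≡0 with trans (sym γ-coeff) γ-coeff≡0
  ... | ()
  above-γ : ∀ β → γ <lex β → coeff r β ≡ + 0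
  above-γ β γ<β = trans (coeff-normalForm (swapAt p α) {r} r-nf β) (nf-above-swapLead 0 p α overflow β γ<β)
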